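{- Let $C_n$ be the cycle on $n\geq 3$ vertices and $k\geq 1$. Then $$\gamma^r_k(C_n)=\begin{cases}2, & \text{if } 4k+1\geq n,\\ 3, & \text{if } n=4k+2,\\ \left\lceil \frac{n}{2k+1}\right\rceil, & \text{if } n\geq 4k+3.\end{cases}$$
   Context: $C_n$ has vertex set $\{0,\dots,n-1\}$ and edges $i(i+1) \pmod n$. For a graph $G=(V,E)$ and $k\geq 1$, a set $D\subseteq V$ is distance $k$-dominating if every $v\in V\setminus D$ is at distance at most $k$ from some vertex of $D$. An ordered set $W=\{w_1,\dots,w_r\}$ is a resolving set if for all distinct $u,v\in V\setminus W$ the distance vectors $(d_G(u,w_i))_i$ and $(d_G(v,w_i))_i$ differ. $\gamma^r_k(G)$ is the minimum cardinality of a set that is both resolving and distance $k$-dominating. -}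

module Defs where

open import Data.Nat using (ℕ; _+_; _*_; _∸_; _≤_; _⊓_; ∣_-_∣; _/_)
open import Data.Fin using (Fin; toℕ)
open import Data.Fin.Subset using (Subset; _∈_; _∉_; ∣_∣)
open import Data.Product using (Σ; ∃; _×_; _,_)
open import Relation.Binary.PropositionalEquality using (_≡_; _≢_)

-- Shortest-path distance in the cycle C_n on vertex set {0,…,n-1}
-- with edges i(i+1) mod n: the shorter of the two arcs between i and j.
cycleDist : (n : ℕ) → Fin n → Fin n → ℕ
cycleDist n i j = ∣ toℕ i - toℕ j ∣ ⊓ (n ∸ ∣ toℕ i - toℕ j ∣)

IsDistKDominating : (n k : ℕ) → Subset n → Set
IsDistKDominating n k D =
  ∀ (v : Fin n) → v ∉ D → Σ (Fin n) λ w → w ∈ D × cycleDist n v w ≤ k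

IsResolving : (n : ℕ) → Subset n → Set
IsResolving n W =
  ∀ (u v : Fin n) → u ∉ W → v ∉ W → u ≢ v →
    Σ (Fin n) λ w → w ∈ W × cycleDist n u w ≢ cycleDist n v w

IsResolvingDistKDominating : (n k : ℕ) → Subset n → Set
IsResolvingDistKDominating n k S = IsResolving n S × IsDistKDominating n k S

GammaRK≡ : (n k m : ℕ) → Set
GammaRK≡ n k m =
  (Σ (Subset n) λ S → IsResolvingDistKDominating n k S × ∣ S ∣ ≡ m)
  × (∀ (S : Subset n) → IsResolvingDistKDominating n k S → m ≤ ∣ S ∣)

ceilDiv2k+1 : (n k : ℕ) → ℕ
ceilDiv2k+1 n k = (n + 2 * k) / (1 + 2 * k)

{-# OPTIONS --safe #-}
module Submission where

-- Upper bounds: with q = 2k + 1, the ⌈n/q⌉ vertices 0, q, 2q, … k-dominate C_n, and the vertices 0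
-- and c resolve C_n whenever 2c ≢ n: the distance to 0 determines a vertex up to the reflection
-- u ↦ n − u, which c breaks. So the progression suffices when q itself can serve as c, and otherwise
-- the vertex 1 is added.
-- Lower bounds: mapping each vertex to a dominating vertex of S together with its offset in
-- [0, 2k] is injective, so n ≤ ∣S∣ q. A single vertex a resolves nothing, as the neighbours of a are
-- equidistant from everything on the axis through a. For n = 2q two vertices that k-dominate C_n
-- must be antipodal, hence again lie on one axis.

open import Defs
open import Data.Nat using (ℕ; _+_; _*_; _≤_; _≥_)
open import Data.Product using (_×_)
open import Relation.Binary.PropositionalEquality using (_≡_)

open import Data.Nat using (zero; suc; _∸_; _<_; _⊓_; ∣_-_∣; z≤n; s≤s; s≤s⁻¹; _<?_; _≤?_; _≟_; _/_; _%_; NonZero)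
open import Data.Nat.DivMod using (m<n*o⇒m/o<n; m≡m%n+[m/n]*n; m%n<n; m%n≤m; m<n⇒m%n≡m; [m+kn]%n≡m%n; m*n%n≡0)
open import Data.Nat.Properties
open import Data.Nat.Tactic.RingSolver using (solve-∀)
open import Data.Product using (Σ; ∃; ∃₂; _,_; proj₁; proj₂)
open import Data.Sum using (_⊎_; inj₁; inj₂)
open import Function using (_∘_; Injective)
open import Relation.Binary.PropositionalEquality
  using (refl; sym; trans; cong; cong₂; subst; subst₂; _≢_; module ≡-Reasoning)
open import Relation.Nullary using (¬_; contradiction; yes; no)
open import Relation.Binary using (tri<; tri≈; tri>)
open import Data.Fin using (Fin; toℕ; fromℕ<; combine)
import Data.Fin as Fin
open import Data.Fin.Properties using (toℕ-injective; toℕ<n; toℕ-fromℕ<; combine-injective; injective⇒≤)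
import Data.Fin.Properties as FinP
open import Data.Fin.Subset using (Subset; _∈_; _∉_; ∣_∣; ⁅_⁆; _∪_; _⊆_; inside; outside)
  renaming (⊥ to ∅)
open import Data.Fin.Subset.Properties
  using (x∈⁅x⁆; x∈⁅y⁆⇒x≡y; x∈p∪q⁺; x∈p∪q⁻; ∣⁅x⁆∣≡1; ∣⊥∣≡0; nonempty?; _∈?_; ∪-comm; q⊆p∪q;
         x∈p∧x≢y⇒x∈p-y; x∈p⇒∣p-x∣<∣p∣)
open import Data.Vec.Base using (_∷_; []; here; there)

variable
  a b c h k n t u v x y δ ε : ℕ
  i j : Fin n
  p S : Subset n

shorterArc : ℕ → ℕ → ℕ
shorterArc n δ = δ ⊓ (n ∸ δ)

cycleDistℕ : ℕ → ℕ → ℕ → ℕ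
cycleDistℕ n x y = shorterArc n ∣ x - y ∣

-- δ ≡ ±ε (mod n): the displacements δ and ε split the cycle into the same two arcs.
SameArcs : ℕ → ℕ → ℕ → Set
SameArcs n δ ε = δ ≡ ε ⊎ δ + ε ≡ n

sameArcs⇒shorterArc-≡ : SameArcs n δ ε → shorterArc n δ ≡ shorterArc n ε
sameArcs⇒shorterArc-≡ (inj₁ refl) = refl
sameArcs⇒shorterArc-≡ {δ = δ} {ε} (inj₂ refl) rewrite m+n∸m≡n δ ε | m+n∸n≡m δ ε = ⊓-comm δ ε

shorterArc-≡⇒sameArcs : δ ≤ n → ε ≤ n → shorterArc n δ ≡ shorterArc n ε → SameArcs n δ ε
shorterArc-≡⇒sameArcs {δ} {n} {ε} δ≤n ε≤n eq with ⊓-sel δ (n ∸ δ) | ⊓-sel ε (n ∸ ε)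
... | inj₁ p | inj₁ q = inj₁ (trans (sym p) (trans eq q))
... | inj₁ p | inj₂ q = inj₂ (trans (cong (_+ ε) (trans (sym p) (trans eq q))) (m∸n+n≡m ε≤n))
... | inj₂ p | inj₁ q = inj₂ (trans (cong (δ +_) (sym (trans (sym p) (trans eq q)))) (m+[n∸m]≡n δ≤n))
... | inj₂ p | inj₂ q = inj₁ (∸-cancelˡ-≡ δ≤n ε≤n (trans (sym p) (trans eq q)))

shorterArc-≤ : δ ≤ k ⊎ n ∸ δ ≤ k → shorterArc n δ ≤ k
shorterArc-≤ {δ} {n = n} (inj₁ δ≤k) = ≤-trans (m⊓n≤m δ (n ∸ δ)) δ≤k
shorterArc-≤ {δ} {n = n} (inj₂ δ′≤k) = ≤-trans (m⊓n≤n δ (n ∸ δ)) δ′≤k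

shorterArc-≤⁻¹ : shorterArc n δ ≤ k → δ ≤ k ⊎ n ∸ δ ≤ k
shorterArc-≤⁻¹ {n} {δ} d≤k with ⊓-sel δ (n ∸ δ)
... | inj₁ p = inj₁ (subst (_≤ _) p d≤k)
... | inj₂ p = inj₂ (subst (_≤ _) p d≤k)

<-shorterArc : k < δ → δ + k < n → k < shorterArc n δ
<-shorterArc {k} {δ} {n} k<δ δ+k<n =
  ⊓-pres-m< k<δ (m+n≤o⇒m≤o∸n (suc k) (subst (_≤ n) (cong suc (+-comm δ k)) δ+k<n))

∣x+δ-x∣≡δ : ∀ x δ → ∣ x + δ - x ∣ ≡ δ
∣x+δ-x∣≡δ x δ = trans (∣-∣-comm (x + δ) x) (∣m-m+n∣≡n x δ)

cycleDistℕ-comm : ∀ n x y → cycleDistℕ n x y ≡ cycleDistℕ n y x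
cycleDistℕ-comm n x y = cong (shorterArc n) (∣-∣-comm x y)

cycleDistℕ-self : ∀ n x → cycleDistℕ n x x ≡ 0
cycleDistℕ-self n x rewrite ∣n-n∣≡0 x = refl

cycleDistℕ-+ : ∀ n x δ → cycleDistℕ n (x + δ) x ≡ shorterArc n δ
cycleDistℕ-+ n x δ = cong (shorterArc n) (∣x+δ-x∣≡δ x δ)

cycleDistℕ≡0⇒≡ : x < n → y < n → cycleDistℕ n x y ≡ 0 → x ≡ y
cycleDistℕ≡0⇒≡ {x} {n} {y} x<n y<n eq with ⊓-sel ∣ x - y ∣ (n ∸ ∣ x - y ∣)
... | inj₁ p = ∣m-n∣≡0⇒m≡n (trans (sym p) eq)
... | inj₂ p = contradiction (m∸n≡0⇒m≤n (trans (sym p) eq)) (<⇒≱ (≤-<-trans (∣m-n∣≤m⊔n x y) (⊔-lub x<n y<n)))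

∣x-y∣≡δ : y + δ ≡ x ⊎ x + δ ≡ y → ∣ x - y ∣ ≡ δ
∣x-y∣≡δ {y} {δ} (inj₁ refl) = ∣x+δ-x∣≡δ y δ
∣x-y∣≡δ {δ = δ} {x} (inj₂ refl) = ∣m-m+n∣≡n x δ

∣-∣-view : ∀ x y → ∃ λ δ → ∣ x - y ∣ ≡ δ × (y + δ ≡ x ⊎ x + δ ≡ y)
∣-∣-view x y with ≤-total y x
... | inj₁ y≤x = let δ , eq = m≤n⇒∃[o]m+o≡n y≤x in δ , ∣x-y∣≡δ (inj₁ eq) , inj₁ eq
... | inj₂ x≤y = let δ , eq = m≤n⇒∃[o]m+o≡n x≤y in δ , ∣x-y∣≡δ (inj₂ eq) , inj₂ eq

x+y≡y⇒x≡0 : ∀ x y → x + y ≡ y → x ≡ 0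
x+y≡y⇒x≡0 x y eq = +-cancelʳ-≡ y x 0 eq

x+[y+z]≡[x+z]+y : ∀ x y z → x + (y + z) ≡ (x + z) + y
x+[y+z]≡[x+z]+y = solve-∀

[x+y]+z≡[x+z]+y : ∀ x y z → (x + y) + z ≡ (x + z) + y
[x+y]+z≡[x+z]+y = solve-∀

x+[y+z]≡y+[x+z] : ∀ x y z → x + (y + z) ≡ y + (x + z)
x+[y+z]≡y+[x+z] = solve-∀

interchange : ∀ w x y z → (w + x) + (y + z) ≡ (w + y) + (x + z)
interchange = solve-∀

[w+x]+[y+z]≡[x+y]+[w+z] : ∀ w x y z → (w + x) + (y + z) ≡ (x + y) + (w + z)
[w+x]+[y+z]≡[x+y]+[w+z] = solve-∀

-- With n = u + v, the vertices u and v are mirror images in the axis through 0; a vertex c off that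
-- axis (0 < c and 2c ≢ n) is equidistant from them only if u ≡ v. δ and ε are their displacements from c.
mirror-images-separated : (c + δ ≡ u ⊎ u + δ ≡ c) → (c + ε ≡ v ⊎ v + ε ≡ c) → SameArcs (u + v) δ ε →
                          0 < c → c < u + v → 0 < u → 0 < v → c + c ≢ u + v → u ≡ v
mirror-images-separated (inj₁ refl) (inj₁ refl) (inj₁ refl) _ _ _ _ _ = refl
mirror-images-separated {c} {δ} {ε = ε} (inj₁ refl) (inj₁ refl) (inj₂ sum) 0<c _ _ _ _ =
  contradiction (m+n≡0⇒m≡0 c (x+y≡y⇒x≡0 (c + c) (δ + ε) (trans (eq c δ ε) (sym sum)))) (>⇒≢ 0<c)
  where eq : ∀ c δ ε → (c + c) + (δ + ε) ≡ (c + δ) + (c + ε)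
        eq = solve-∀
mirror-images-separated {δ = δ} {v = v} (inj₁ refl) (inj₂ refl) (inj₁ refl) _ _ _ _ c+c≢u+v =
  contradiction (eq v δ) c+c≢u+v
  where eq : ∀ v δ → (v + δ) + (v + δ) ≡ ((v + δ) + δ) + v
        eq = solve-∀
mirror-images-separated {δ = δ} {ε = ε} {v = v} (inj₁ refl) (inj₂ refl) (inj₂ sum) _ _ _ 0<v _ =
  contradiction (m+n≡0⇒m≡0 v (x+y≡y⇒x≡0 (v + v) (δ + ε) (trans (eq v δ ε) (sym sum)))) (>⇒≢ 0<v)
  where eq : ∀ v δ ε → (v + v) + (δ + ε) ≡ ((v + ε) + δ) + v
        eq = solve-∀
mirror-images-separated {δ = δ} {u} (inj₂ refl) (inj₁ refl) (inj₁ refl) _ _ _ _ c+c≢u+v =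
  contradiction (eq u δ) c+c≢u+v
  where eq : ∀ u δ → (u + δ) + (u + δ) ≡ u + ((u + δ) + δ)
        eq = solve-∀
mirror-images-separated {δ = δ} {u} {ε} (inj₂ refl) (inj₁ refl) (inj₂ sum) _ _ 0<u _ _ =
  contradiction (m+n≡0⇒m≡0 u (x+y≡y⇒x≡0 (u + u) (δ + ε) (trans (eq u δ ε) (sym sum)))) (>⇒≢ 0<u)
  where eq : ∀ u δ ε → (u + u) + (δ + ε) ≡ u + ((u + δ) + ε)
        eq = solve-∀
mirror-images-separated (inj₂ refl) (inj₂ e) (inj₁ refl) _ _ _ _ _ = sym (+-cancelʳ-≡ _ _ _ e)
mirror-images-separated {δ = δ} {u} {ε} {v} (inj₂ refl) (inj₂ e) (inj₂ sum) _ c<u+v _ _ _ =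
  contradiction 2c≡2[u+v] (<⇒≢ (+-mono-< c<u+v c<u+v))
  where
    open ≡-Reasoning
    2c≡2[u+v] : (u + δ) + (u + δ) ≡ (u + v) + (u + v)
    2c≡2[u+v] = begin
      (u + δ) + (u + δ)   ≡⟨ cong ((u + δ) +_) (sym e) ⟩
      (u + δ) + (v + ε)   ≡⟨ interchange u δ v ε ⟩
      (u + v) + (δ + ε)   ≡⟨ cong ((u + v) +_) sum ⟩
      (u + v) + (u + v)   ∎

∣x-y∣≤n : x < n → y < n → ∣ x - y ∣ ≤ n
∣x-y∣≤n {x} {y = y} x<n y<n = ≤-trans (∣m-n∣≤m⊔n x y) (<⇒≤ (⊔-lub x<n y<n))

equidistant-from-0-and-c⇒≡ : u < n → v < n → 0 < c → c < n → c + c ≢ n →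
  cycleDistℕ n u 0 ≡ cycleDistℕ n v 0 → cycleDistℕ n u c ≡ cycleDistℕ n v c → u ≡ v
equidistant-from-0-and-c⇒≡ {u} {n} {v} {c} u<n v<n 0<c c<n c+c≢n eq₀ eqc
  with shorterArc-≡⇒sameArcs (<⇒≤ u<n) (<⇒≤ v<n)
         (subst₂ (λ x y → shorterArc n x ≡ shorterArc n y) (∣-∣-identityʳ u) (∣-∣-identityʳ v) eq₀)
... | inj₁ u≡v = u≡v
... | inj₂ refl with ∣-∣-view u c | ∣-∣-view v c
... | δ , refl , u∼c | ε , refl , v∼c =
  mirror-images-separated u∼c v∼c (shorterArc-≡⇒sameArcs (∣x-y∣≤n u<n c<n) (∣x-y∣≤n v<n c<n) eqc)
    0<c c<n (+-cancelʳ-< v 0 u v<n) (+-cancelˡ-< u 0 v (subst (_< u + v) (sym (+-identityʳ u)) u<n)) c+c≢n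

-- u + v ≡ 2t (mod n), i.e. u and v are mirror images in the axis through t.
SymmetricAbout : ℕ → ℕ → ℕ → ℕ → Set
SymmetricAbout n u v t = u + v ≡ t + t ⊎ u + v ≡ (t + t) + n ⊎ (u + v) + n ≡ t + t

symmetric⇒sameArcs : u < n → v < n → t < n → SymmetricAbout n u v t → SameArcs n ∣ u - t ∣ ∣ v - t ∣
symmetric⇒sameArcs {u} {n} {v} {t} u<n v<n t<n sym-about with ∣-∣-view u t
symmetric⇒sameArcs {u} {n} {v} {t} u<n v<n t<n (inj₁ u+v≡2t) | δ , ∣u-t∣≡δ , inj₁ refl =
  inj₁ (trans ∣u-t∣≡δ (sym (∣x-y∣≡δ (inj₂ v+δ≡t))))
  where
    v+δ≡t : v + δ ≡ t
    v+δ≡t = +-cancelˡ-≡ t (v + δ) t (trans (x+[y+z]≡[x+z]+y t v δ) u+v≡2t)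
symmetric⇒sameArcs {u} {n} {v} {t} u<n v<n t<n (inj₁ u+v≡2t) | δ , ∣u-t∣≡δ , inj₂ refl =
  inj₁ (trans ∣u-t∣≡δ (sym (∣x-y∣≡δ (inj₁ t+δ≡v))))
  where
    t+δ≡v : (u + δ) + δ ≡ v
    t+δ≡v = +-cancelˡ-≡ u ((u + δ) + δ) v (trans (x+[y+z]≡[x+z]+y u (u + δ) δ) (sym u+v≡2t))
symmetric⇒sameArcs {u} {n} {v} {t} u<n v<n t<n (inj₂ (inj₁ u+v≡2t+n)) | δ , ∣u-t∣≡δ , inj₁ refl
  with m≤n⇒∃[o]m+o≡n (≤-trans (m≤n+m δ t) (<⇒≤ u<n))
... | ε , refl = inj₂ (cong₂ _+_ ∣u-t∣≡δ (∣x-y∣≡δ (inj₁ (sym v≡t+ε))))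
  where
    v≡t+ε : v ≡ t + ε
    v≡t+ε = +-cancelˡ-≡ (t + δ) v (t + ε) (trans u+v≡2t+n (interchange t t δ ε))
symmetric⇒sameArcs {u} {n} {v} {t} u<n v<n t<n (inj₂ (inj₁ u+v≡2t+n)) | δ , _ , inj₂ refl =
  contradiction u+v≡2t+n
    (<⇒≢ (<-≤-trans (+-monoʳ-< u v<n) (+-monoˡ-≤ n (≤-trans (m≤m+n u δ) (m≤m+n (u + δ) (u + δ))))))
symmetric⇒sameArcs {u} {n} {v} {t} u<n v<n t<n (inj₂ (inj₂ u+v+n≡2t)) | δ , _ , inj₁ refl =
  contradiction (sym u+v+n≡2t)
    (<⇒≢ (<-≤-trans (+-monoʳ-< t t<n) (+-monoˡ-≤ n (≤-trans (m≤m+n t δ) (m≤m+n (t + δ) v)))))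
symmetric⇒sameArcs {u} {n} {v} {t} u<n v<n t<n (inj₂ (inj₂ u+v+n≡2t)) | δ , ∣u-t∣≡δ , inj₂ refl
  with m≤n⇒∃[o]m+o≡n (≤-trans (m≤n+m δ u) (<⇒≤ t<n))
... | ε , refl = inj₂ (cong₂ _+_ ∣u-t∣≡δ (∣x-y∣≡δ (inj₂ v+ε≡t)))
  where
    v+ε≡t : v + ε ≡ u + δ
    v+ε≡t = +-cancelˡ-≡ (u + δ) (v + ε) (u + δ) (trans (sym (interchange u v δ ε)) u+v+n≡2t)

symmetric⇒equidistant : u < n → v < n → t < n → SymmetricAbout n u v t → cycleDistℕ n u t ≡ cycleDistℕ n v t
symmetric⇒equidistant u<n v<n t<n = sameArcs⇒shorterArc-≡ ∘ symmetric⇒sameArcs u<n v<n t<n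

symmetricAbout-antipode : n ≡ h + h → a + h < n → SymmetricAbout n u v a → SymmetricAbout n u v (a + h)
symmetricAbout-antipode {h = h} {a} {u} {v} refl _ (inj₁ u+v≡2a) =
  inj₂ (inj₂ (trans (cong (_+ (h + h)) u+v≡2a) (interchange a a h h)))
symmetricAbout-antipode {h = h} {a} {u} {v} refl _ (inj₂ (inj₁ u+v≡2a+n)) =
  inj₁ (trans u+v≡2a+n (interchange a a h h))
symmetricAbout-antipode {h = h} {a} {u} {v} refl a+h<n (inj₂ (inj₂ u+v+n≡2a)) =
  contradiction u+v+n≡2a (>⇒≢ (<-≤-trans 2a<n (m≤n+m (h + h) (u + v))))
  where
    a<h : a < h
    a<h = +-cancelʳ-< h a h a+h<n
    2a<n : a + a < h + h
    2a<n = +-mono-< a<h a<h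

neighbours-symmetric : 3 ≤ n → a < n → ∃₂ λ u v → u < n × v < n × u ≢ v × SymmetricAbout n u v a
neighbours-symmetric {suc n′} {zero} 3≤n _ =
  1 , n′ , s≤s (≤-trans (s≤s z≤n) (s≤s⁻¹ 3≤n)) , n<1+n n′ , <⇒≢ (s≤s⁻¹ 3≤n) , inj₂ (inj₁ refl)
neighbours-symmetric {n} {suc a′} 3≤n a<n with suc (suc a′) <? n
... | yes a+1<n =
  suc (suc a′) , a′ , a+1<n , <-trans (n<1+n a′) a<n , >⇒≢ (m<n⇒m<1+n (n<1+n a′)) ,
  inj₁ (sym (+-suc (suc a′) a′))
... | no a+1≮n =
  0 , a′ , ≤-trans (s≤s z≤n) 3≤n , <-trans (n<1+n a′) a<n , <⇒≢ 0<a′ ,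
  inj₂ (inj₂ (trans (cong (a′ +_) n≡a+1) (+-suc a′ (suc a′))))
  where
    n≡a+1 : n ≡ suc (suc a′)
    n≡a+1 = ≤-antisym (≮⇒≥ a+1≮n) a<n
    0<a′ : 0 < a′
    0<a′ = s≤s⁻¹ (s≤s⁻¹ (subst (3 ≤_) n≡a+1 3≤n))

resolving-if-0-and-c : (z c : Fin n) → toℕ z ≡ 0 → z ∈ S → c ∈ S → 0 < toℕ c → toℕ c + toℕ c ≢ n →
                       IsResolving n S
resolving-if-0-and-c {n} z c z≡0 z∈S c∈S 0<c c+c≢n u v _ _ u≢v
  with cycleDist n u z ≟ cycleDist n v z | cycleDist n u c ≟ cycleDist n v c
... | no ≢z | _     = z , z∈S , ≢z
... | yes _ | no ≢c = c , c∈S , ≢c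
... | yes ≡z | yes ≡c = contradiction u≡v u≢v
  where
    ≡0 : cycleDistℕ n (toℕ u) 0 ≡ cycleDistℕ n (toℕ v) 0
    ≡0 = subst (λ t → cycleDistℕ n (toℕ u) t ≡ cycleDistℕ n (toℕ v) t) z≡0 ≡z
    u≡v : u ≡ v
    u≡v = toℕ-injective (equidistant-from-0-and-c⇒≡ (toℕ<n u) (toℕ<n v) 0<c (toℕ<n c) c+c≢n ≡0 ≡c)

¬resolving-if-equidistant : (u v : Fin n) → u ≢ v → (∀ {w} → w ∈ S → cycleDist n u w ≡ cycleDist n v w) →
                            ¬ IsResolving n S
¬resolving-if-equidistant {n} {S} u v u≢v equidistant resolving =
  let w , w∈S , separates = resolving u v u∉S v∉S u≢v in separates (equidistant w∈S)
  where
    u∉S : u ∉ S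
    u∉S u∈S = u≢v (sym (toℕ-injective (cycleDistℕ≡0⇒≡ (toℕ<n v) (toℕ<n u)
                (trans (sym (equidistant u∈S)) (cycleDistℕ-self n (toℕ u))))))
    v∉S : v ∉ S
    v∉S v∈S = u≢v (toℕ-injective (cycleDistℕ≡0⇒≡ (toℕ<n u) (toℕ<n v)
                (trans (equidistant v∈S) (cycleDistℕ-self n (toℕ v)))))

OnAxisThrough : ℕ → ℕ → ℕ → Set
OnAxisThrough n a t = t ≡ a ⊎ ∃ λ h → n ≡ h + h × a + h ≡ t

¬resolving-⊆-axis : 3 ≤ n → (a : Fin n) → (∀ {w} → w ∈ S → OnAxisThrough n (toℕ a) (toℕ w)) → ¬ IsResolving n S
¬resolving-⊆-axis {n} {S = S} 3≤n a on-axis with neighbours-symmetric 3≤n (toℕ<n a)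
... | u , v , u<n , v<n , u≢v , symmetric-about-a =
  ¬resolving-if-equidistant (fromℕ< u<n) (fromℕ< v<n) (u≢v ∘ toℕ≡ ∘ cong toℕ) equidistant
  where
    toℕ≡ : toℕ (fromℕ< u<n) ≡ toℕ (fromℕ< v<n) → u ≡ v
    toℕ≡ eq = trans (sym (toℕ-fromℕ< u<n)) (trans eq (toℕ-fromℕ< v<n))
    symmetric-about : ∀ {w} → w ∈ S → SymmetricAbout n u v (toℕ w)
    symmetric-about w∈S with on-axis w∈S
    ... | inj₁ w≡a = subst (SymmetricAbout n u v) (sym w≡a) symmetric-about-a
    ... | inj₂ (h , n≡2h , a+h≡w) = subst (SymmetricAbout n u v) a+h≡w
          (symmetricAbout-antipode {h = h} {a = toℕ a} {u} {v} n≡2h (subst (_< n) (sym a+h≡w) (toℕ<n _))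
            symmetric-about-a)
    equidistant : ∀ {w} → w ∈ S → cycleDist n (fromℕ< u<n) w ≡ cycleDist n (fromℕ< v<n) w
    equidistant {w} w∈S rewrite toℕ-fromℕ< u<n | toℕ-fromℕ< v<n =
      symmetric⇒equidistant u<n v<n (toℕ<n w) (symmetric-about w∈S)

rank : i ∈ p → Fin ∣ p ∣
rank {p = inside  ∷ p} here        = Fin.zero
rank {p = inside  ∷ p} (there i∈p) = Fin.suc (rank i∈p)
rank {p = outside ∷ p} (there i∈p) = rank i∈p

rank-injective : (i∈p : i ∈ p) (j∈p : j ∈ p) → rank i∈p ≡ rank j∈p → i ≡ j
rank-injective {p = inside  ∷ p} here        here        _  = refl
rank-injective {p = inside  ∷ p} (there i∈p) (there j∈p) eq =
  cong Fin.suc (rank-injective i∈p j∈p (FinP.suc-injective eq))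
rank-injective {p = outside ∷ p} (there i∈p) (there j∈p) eq = cong Fin.suc (rank-injective i∈p j∈p eq)

∣p∣≤1⇒∈-unique : ∣ p ∣ ≤ 1 → i ∈ p → j ∈ p → i ≡ j
∣p∣≤1⇒∈-unique ∣p∣≤1 i∈p j∈p = rank-injective i∈p j∈p (toℕ-injective (trans (rank≡0 i∈p) (sym (rank≡0 j∈p))))
  where rank≡0 : ∀ {i} (i∈p : i ∈ _) → toℕ (rank i∈p) ≡ 0
        rank≡0 i∈p = n<1⇒n≡0 (<-≤-trans (toℕ<n (rank i∈p)) ∣p∣≤1)

∣p∣≤1⇒⊆⁅i⁆ : {p : Subset n} → Fin n → ∣ p ∣ ≤ 1 → ∃ λ i → p ⊆ ⁅ i ⁆
∣p∣≤1⇒⊆⁅i⁆ {p = p} i₀ ∣p∣≤1 with nonempty? p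
... | no ∄ = i₀ , λ j∈p → contradiction (_ , j∈p) ∄
... | yes (i , i∈p) = i , λ j∈p → subst (_∈ ⁅ i ⁆) (∣p∣≤1⇒∈-unique ∣p∣≤1 i∈p j∈p) (x∈⁅x⁆ i)

∣p∣≤2⇒⊆⁅i⁆∪⁅j⁆ : {p : Subset n} → Fin n → ∣ p ∣ ≤ 2 → ∃₂ λ i j → p ⊆ ⁅ i ⁆ ∪ ⁅ j ⁆
∣p∣≤2⇒⊆⁅i⁆∪⁅j⁆ {p = p} i₀ ∣p∣≤2 with nonempty? p
... | no ∄ = i₀ , i₀ , λ l∈p → contradiction (_ , l∈p) ∄
... | yes (i , i∈p) with ∣p∣≤1⇒⊆⁅i⁆ i₀ (s≤s⁻¹ (<-≤-trans (x∈p⇒∣p-x∣<∣p∣ i∈p) ∣p∣≤2))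
...   | j , p∖i⊆⁅j⁆ = i , j , ⊆⁅i⁆∪⁅j⁆
  where
    ⊆⁅i⁆∪⁅j⁆ : p ⊆ ⁅ i ⁆ ∪ ⁅ j ⁆
    ⊆⁅i⁆∪⁅j⁆ {l} l∈p with l Fin.≟ i
    ... | yes refl = x∈p∪q⁺ (inj₁ (x∈⁅x⁆ l))
    ... | no l≢i = x∈p∪q⁺ (inj₂ (p∖i⊆⁅j⁆ (x∈p∧x≢y⇒x∈p-y l∈p l≢i)))

∣p∪q∣≤∣p∣+∣q∣ : ∀ (p q : Subset n) → ∣ p ∪ q ∣ ≤ ∣ p ∣ + ∣ q ∣
∣p∪q∣≤∣p∣+∣q∣ []             []             = z≤n
∣p∪q∣≤∣p∣+∣q∣ (inside  ∷ p) (inside  ∷ q) = s≤s (≤-trans (∣p∪q∣≤∣p∣+∣q∣ p q) (+-monoʳ-≤ ∣ p ∣ (n≤1+n ∣ q ∣)))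
∣p∪q∣≤∣p∣+∣q∣ (inside  ∷ p) (outside ∷ q) = s≤s (∣p∪q∣≤∣p∣+∣q∣ p q)
∣p∪q∣≤∣p∣+∣q∣ (outside ∷ p) (inside  ∷ q) = subst (∣ p ∪ q ∣ <_) (sym (+-suc ∣ p ∣ ∣ q ∣)) (s≤s (∣p∪q∣≤∣p∣+∣q∣ p q))
∣p∪q∣≤∣p∣+∣q∣ (outside ∷ p) (outside ∷ q) = ∣p∪q∣≤∣p∣+∣q∣ p q

-- ⁅ x ⁆ for x < n and ∅ otherwise, so that vertices can be named by natural numbers.
pointSet : ℕ → Subset n
pointSet {n} x with x <? n
... | yes x<n = ⁅ fromℕ< x<n ⁆
... | no _    = ∅

∈pointSet : toℕ i ≡ x → i ∈ pointSet x
∈pointSet {n} {i} {x} i≡x with x <? n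
... | yes x<n = subst (_∈ ⁅ fromℕ< x<n ⁆) (toℕ-injective (trans (toℕ-fromℕ< x<n) (sym i≡x))) (x∈⁅x⁆ _)
... | no x≮n  = contradiction (subst (_< n) i≡x (toℕ<n i)) x≮n

∣pointSet∣≤1 : ∀ x → ∣ pointSet {n} x ∣ ≤ 1
∣pointSet∣≤1 {n} x with x <? n
... | yes x<n = ≤-reflexive (∣⁅x⁆∣≡1 (fromℕ< x<n))
... | no _    = ≤-trans (≤-reflexive (∣⊥∣≡0 n)) z≤n

progression : ℕ → ℕ → Subset n
progression q zero    = ∅
progression q (suc m) = pointSet (m * q) ∪ progression q m

∣progression∣≤m : ∀ q m → ∣ progression {n} q m ∣ ≤ m
∣progression∣≤m {n} q zero    = ≤-reflexive (∣⊥∣≡0 n)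
∣progression∣≤m {n} q (suc m) =
  ≤-trans (∣p∪q∣≤∣p∣+∣q∣ (pointSet (m * q)) (progression q m))
    (+-mono-≤ (∣pointSet∣≤1 {n} (m * q)) (∣progression∣≤m {n} q m))

∈progression : ∀ {q m j} → j < m → toℕ i ≡ j * q → i ∈ progression q m
∈progression {q = q} {suc m} {j} j<1+m i≡jq with m<1+n⇒m<n∨m≡n j<1+m
... | inj₂ refl = x∈p∪q⁺ (inj₁ (∈pointSet i≡jq))
... | inj₁ j<m  = x∈p∪q⁺ (inj₂ (∈progression j<m i≡jq))

module _ {n k : ℕ} {S : Subset n} (m : ℕ) (n≤mq : n ≤ m * (1 + 2 * k))
         (prog⊆S : progression (1 + 2 * k) m ⊆ S) where
  private
    q = 1 + 2 * k

    near-multiple : ∀ x j → j * q < n → cycleDistℕ n x (j * q) ≤ k →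
                    Σ (Fin n) λ w → w ∈ S × cycleDistℕ n x (toℕ w) ≤ k
    near-multiple x j jq<n d≤k =
      w , prog⊆S (∈progression (*-cancelʳ-< q j m (<-≤-trans jq<n n≤mq)) w≡jq) ,
      subst (λ y → cycleDistℕ n x y ≤ k) (sym w≡jq) d≤k
      where
        w = fromℕ< jq<n
        w≡jq = toℕ-fromℕ< jq<n

    gap-to-next-multiple : ∀ t r → r < q → k < r → ∃ λ s → s ≤ k × (t * q + r) + s ≡ suc t * q
    gap-to-next-multiple t r r<q k<r = q ∸ r , s≤k , x+s≡[t+1]q
      where
        s≤k : q ∸ r ≤ k
        s≤k = m≤n+o⇒m∸n≤o q r (≤-trans (≤-reflexive (cong suc (cong (k +_) (+-identityʳ k)))) (+-monoˡ-≤ k k<r))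
        x+s≡[t+1]q : (t * q + r) + (q ∸ r) ≡ suc t * q
        x+s≡[t+1]q = trans (+-assoc (t * q) r _) (trans (cong (t * q +_) (m+[n∸m]≡n (<⇒≤ r<q))) (+-comm (t * q) q))

    -- As q = 2k + 1, x = t q + r is within k of t q or of (t + 1) q; the latter is replaced by the
    -- vertex 0 when (t + 1) q wraps round the cycle.
    near-block : ∀ x t r → x ≡ t * q + r → r < q → x < n → Σ (Fin n) λ w → w ∈ S × cycleDistℕ n x (toℕ w) ≤ k
    near-block _ t r refl r<q x<n with r ≤? k
    ... | yes r≤k =
      near-multiple (t * q + r) t (≤-<-trans (m≤m+n (t * q) r) x<n)
        (≤-trans (≤-reflexive (cycleDistℕ-+ n (t * q) r)) (shorterArc-≤ (inj₁ r≤k)))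
    ... | no r≰k with gap-to-next-multiple t r r<q (≰⇒> r≰k) | suc t * q <? n
    ...   | s , s≤k , x+s≡[t+1]q | yes [t+1]q<n =
      near-multiple (t * q + r) (suc t) [t+1]q<n
        (subst (λ y → cycleDistℕ n (t * q + r) y ≤ k) x+s≡[t+1]q
          (≤-trans (≤-reflexive (trans (cycleDistℕ-comm n (t * q + r) _) (cycleDistℕ-+ n (t * q + r) s)))
            (shorterArc-≤ (inj₁ s≤k))))
    ...   | s , s≤k , x+s≡[t+1]q | no [t+1]q≮n =
      near-multiple (t * q + r) 0 (≤-<-trans z≤n x<n)
        (≤-trans (≤-reflexive (cycleDistℕ-+ n 0 (t * q + r)))
          (shorterArc-≤ (inj₂ (≤-trans (m≤n+o⇒m∸n≤o n (t * q + r) n≤x+s) s≤k))))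
      where
        n≤x+s : n ≤ (t * q + r) + s
        n≤x+s = subst (n ≤_) (sym x+s≡[t+1]q) (≮⇒≥ [t+1]q≮n)

  progression-dominating : IsDistKDominating n k S
  progression-dominating v _ =
    near-block (toℕ v) (toℕ v / q) (toℕ v % q) (trans (m≡m%n+[m/n]*n (toℕ v) q) (+-comm (toℕ v % q) _))
      (m%n<n (toℕ v) q) (toℕ<n v)

private
  +-%-injectiveˡ-≤ : ∀ {n} .{{_ : NonZero n}} c → x ≤ y → y < n → (x + c) % n ≡ (y + c) % n → x ≡ y
  +-%-injectiveˡ-≤ {x} {n = n} c x≤y y<n eq with m≤n⇒∃[o]m+o≡n x≤y
  ... | d , refl = sym (trans (cong (x +_) d≡0) (+-identityʳ x))
    where
      open ≡-Reasoning
      X = x + c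
      Y = (x + d) + c
      dX≡Y : d + (X / n) * n ≡ (Y / n) * n
      dX≡Y = +-cancelˡ-≡ (X % n) _ _ (begin
        X % n + (d + (X / n) * n)   ≡⟨ x+[y+z]≡[x+z]+y (X % n) d ((X / n) * n) ⟩
        (X % n + (X / n) * n) + d   ≡⟨ cong (_+ d) (sym (m≡m%n+[m/n]*n X n)) ⟩
        X + d                       ≡⟨ [x+y]+z≡[x+z]+y x c d ⟩
        Y                           ≡⟨ m≡m%n+[m/n]*n Y n ⟩
        Y % n + (Y / n) * n         ≡⟨ cong (_+ (Y / n) * n) (sym eq) ⟩
        X % n + (Y / n) * n         ∎)
      d≡0 : d ≡ 0
      d≡0 = begin
        d                       ≡⟨ sym (m<n⇒m%n≡m (m+n≤o⇒n≤o x (subst (_≤ n) (sym (+-suc x d)) y<n))) ⟩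
        d % n                   ≡⟨ sym ([m+kn]%n≡m%n d (X / n) n) ⟩
        (d + (X / n) * n) % n   ≡⟨ cong (_% n) dX≡Y ⟩
        ((Y / n) * n) % n       ≡⟨ m*n%n≡0 (Y / n) n ⟩
        0                       ∎

+-%-injectiveˡ : ∀ {n} .{{_ : NonZero n}} c → x < n → y < n → (x + c) % n ≡ (y + c) % n → x ≡ y
+-%-injectiveˡ {x} {y} c x<n y<n eq with ≤-total x y
... | inj₁ x≤y = +-%-injectiveˡ-≤ c x≤y y<n eq
... | inj₂ y≤x = sym (+-%-injectiveˡ-≤ c y≤x x<n (sym eq))

m≡r+kn⇒m%n≤r : ∀ {m r} k n .{{_ : NonZero n}} → m ≡ r + k * n → m % n ≤ r
m≡r+kn⇒m%n≤r {r = r} k n refl = ≤-trans (≤-reflexive ([m+kn]%n≡m%n r k n)) (m%n≤m r n)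

private
  k≤2k : ∀ k → k ≤ 2 * k
  k≤2k k = m≤m+n k (k + 0)

  offset-≤-ahead : ∀ {k n} .{{_ : NonZero n}} y δ → y < n → δ ≤ n → shorterArc n δ ≤ k →
                   ((y + δ) + (k + (n ∸ y))) % n ≤ 2 * k
  offset-≤-ahead {k} {n} y δ y<n δ≤n d≤k with shorterArc-≤⁻¹ {n} {δ} d≤k
  ... | inj₁ δ≤k = ≤-trans (m≡r+kn⇒m%n≤r 1 n X≡) (+-mono-≤ δ≤k (≤-reflexive (sym (+-identityʳ k))))
    where
      open ≡-Reasoning
      X≡ : (y + δ) + (k + (n ∸ y)) ≡ (δ + k) + 1 * n
      X≡ = begin
        (y + δ) + (k + (n ∸ y))   ≡⟨ [w+x]+[y+z]≡[x+y]+[w+z] y δ k (n ∸ y) ⟩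
        (δ + k) + (y + (n ∸ y))   ≡⟨ cong ((δ + k) +_) (m+[n∸m]≡n (<⇒≤ y<n)) ⟩
        (δ + k) + n               ≡⟨ cong ((δ + k) +_) (sym (*-identityˡ n)) ⟩
        (δ + k) + 1 * n           ∎
  ... | inj₂ e≤k = ≤-trans (m≡r+kn⇒m%n≤r 2 n X≡) (≤-trans (m∸n≤m k e) (k≤2k k))
    where
      open ≡-Reasoning
      e = n ∸ δ
      f = k ∸ e
      regroup : ∀ δ e f n → (δ + (e + f)) + n ≡ f + ((δ + e) + n)
      regroup = solve-∀
      X≡ : (y + δ) + (k + (n ∸ y)) ≡ f + 2 * n
      X≡ = begin
        (y + δ) + (k + (n ∸ y))   ≡⟨ [w+x]+[y+z]≡[x+y]+[w+z] y δ k (n ∸ y) ⟩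
        (δ + k) + (y + (n ∸ y))   ≡⟨ cong₂ (λ k n → (δ + k) + n) (sym (m+[n∸m]≡n e≤k)) (m+[n∸m]≡n (<⇒≤ y<n)) ⟩
        (δ + (e + f)) + n         ≡⟨ regroup δ e f n ⟩
        f + ((δ + e) + n)         ≡⟨ cong (λ m → f + (m + n)) (m+[n∸m]≡n δ≤n) ⟩
        f + (n + n)               ≡⟨ cong (λ m → f + (n + m)) (sym (+-identityʳ n)) ⟩
        f + 2 * n                 ∎

  offset-≤-behind : ∀ {k n} .{{_ : NonZero n}} x δ → x + δ < n → δ ≤ n → shorterArc n δ ≤ k →
                    (x + (k + (n ∸ (x + δ)))) % n ≤ 2 * k
  offset-≤-behind {k} {n} x δ y<n δ≤n d≤k with shorterArc-≤⁻¹ {n} {δ} d≤k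
  ... | inj₁ δ≤k = ≤-trans (m≡r+kn⇒m%n≤r 1 n X≡) (≤-trans (m∸n≤m k δ) (k≤2k k))
    where
      open ≡-Reasoning
      f = k ∸ δ
      regroup : ∀ x δ f y′ → x + ((δ + f) + y′) ≡ f + ((x + δ) + y′)
      regroup = solve-∀
      X≡ : x + (k + (n ∸ (x + δ))) ≡ f + 1 * n
      X≡ = begin
        x + (k + (n ∸ (x + δ)))         ≡⟨ cong (λ k → x + (k + (n ∸ (x + δ)))) (sym (m+[n∸m]≡n δ≤k)) ⟩
        x + ((δ + f) + (n ∸ (x + δ)))   ≡⟨ regroup x δ f (n ∸ (x + δ)) ⟩
        f + ((x + δ) + (n ∸ (x + δ)))   ≡⟨ cong (f +_) (m+[n∸m]≡n (<⇒≤ y<n)) ⟩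
        f + n                           ≡⟨ cong (f +_) (sym (*-identityˡ n)) ⟩
        f + 1 * n                       ∎
  ... | inj₂ e≤k = ≤-trans (m≡r+kn⇒m%n≤r 0 n X≡) (+-monoʳ-≤ k (≤-trans e≤k (≤-reflexive (sym (+-identityʳ k)))))
    where
      open ≡-Reasoning
      e = n ∸ δ
      x+y′≡e : x + (n ∸ (x + δ)) ≡ e
      x+y′≡e = +-cancelˡ-≡ δ _ _ (begin
        δ + (x + (n ∸ (x + δ)))   ≡⟨ x+[y+z]≡y+[x+z] δ x _ ⟩
        x + (δ + (n ∸ (x + δ)))   ≡⟨ sym (+-assoc x δ _) ⟩
        (x + δ) + (n ∸ (x + δ))   ≡⟨ m+[n∸m]≡n (<⇒≤ y<n) ⟩
        n                         ≡⟨ sym (m+[n∸m]≡n δ≤n) ⟩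
        δ + e                     ∎)
      X≡ : x + (k + (n ∸ (x + δ))) ≡ (k + e) + 0 * n
      X≡ = begin
        x + (k + (n ∸ (x + δ)))   ≡⟨ x+[y+z]≡y+[x+z] x k _ ⟩
        k + (x + (n ∸ (x + δ)))   ≡⟨ cong (k +_) x+y′≡e ⟩
        k + e                     ≡⟨ sym (+-identityʳ (k + e)) ⟩
        (k + e) + 0 * n           ∎

-- (x + (k + (n ∸ y))) % n is the position of x counted from y − k round the cycle.
offset-≤ : ∀ {n} .{{_ : NonZero n}} → x < n → y < n → cycleDistℕ n x y ≤ k → (x + (k + (n ∸ y))) % n ≤ 2 * k
offset-≤ {x} {y} {k} {n} x<n y<n d≤k with ∣-∣-view x y
... | δ , ∣x-y∣≡δ , inj₁ refl =
  offset-≤-ahead y δ y<n (subst (_≤ n) ∣x-y∣≡δ (∣x-y∣≤n x<n y<n)) (subst (λ δ → shorterArc n δ ≤ k) ∣x-y∣≡δ d≤k)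
... | δ , ∣x-y∣≡δ , inj₂ refl =
  offset-≤-behind x δ y<n (subst (_≤ n) ∣x-y∣≡δ (∣x-y∣≤n x<n y<n)) (subst (λ δ → shorterArc n δ ≤ k) ∣x-y∣≡δ d≤k)

dominating⇒n≤∣S∣*[1+2k] : IsDistKDominating n k S → n ≤ ∣ S ∣ * (1 + 2 * k)
dominating⇒n≤∣S∣*[1+2k] {zero} _ = z≤n
dominating⇒n≤∣S∣*[1+2k] {n@(suc _)} {k} {S} dominating = injective⇒≤ encode-injective
  where
    dominator : (v : Fin n) → Σ (Fin n) λ w → w ∈ S × cycleDist n v w ≤ k
    dominator v with v ∈? S
    ... | yes v∈S = v , v∈S , ≤-trans (≤-reflexive (cycleDistℕ-self n (toℕ v))) z≤n
    ... | no v∉S  = dominating v v∉S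

    offset : Fin n → ℕ
    offset v = (toℕ v + (k + (n ∸ toℕ (proj₁ (dominator v))))) % n

    offset<1+2k : ∀ v → offset v < 1 + 2 * k
    offset<1+2k v = let w , _ , d≤k = dominator v in s≤s (offset-≤ (toℕ<n v) (toℕ<n w) d≤k)

    dominator-rank : Fin n → Fin ∣ S ∣
    dominator-rank v = rank (proj₁ (proj₂ (dominator v)))

    encode : Fin n → Fin (∣ S ∣ * (1 + 2 * k))
    encode v = combine (dominator-rank v) (fromℕ< (offset<1+2k v))

    encode-injective : Injective _≡_ _≡_ encode
    encode-injective {v₁} {v₂} eq with combine-injective (dominator-rank v₁) (fromℕ< (offset<1+2k v₁))
                                                   (dominator-rank v₂) (fromℕ< (offset<1+2k v₂)) eq
    ... | same-rank , same-offset = toℕ-injective (+-%-injectiveˡ _ (toℕ<n v₁) (toℕ<n v₂) offsets≡)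
      where
        same-dominator : proj₁ (dominator v₁) ≡ proj₁ (dominator v₂)
        same-dominator = rank-injective (proj₁ (proj₂ (dominator v₁))) (proj₁ (proj₂ (dominator v₂))) same-rank
        offsets≡ : offset v₁ ≡ (toℕ v₂ + (k + (n ∸ toℕ (proj₁ (dominator v₁))))) % n
        offsets≡ = trans (trans (sym (toℕ-fromℕ< (offset<1+2k v₁))) (cong toℕ same-offset))
                     (trans (toℕ-fromℕ< (offset<1+2k v₂))
                       (cong (λ w → (toℕ v₂ + (k + (n ∸ toℕ w))) % n) (sym same-dominator)))

<-witness : ∀ {m n} j → m + suc j ≡ n → m < n
<-witness {m} j refl = m<m+n m (s≤s z≤n)

far-arc : ∀ {n k} x δ → k < δ → δ + k < n → k < cycleDistℕ n (x + δ) x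
far-arc {n} {k} x δ k<δ δ+k<n = subst (k <_) (sym (cycleDistℕ-+ n x δ)) (<-shorterArc k<δ δ+k<n)

far-arc′ : ∀ {n k} x δ → k < δ → δ + k < n → k < cycleDistℕ n x (x + δ)
far-arc′ {n} x δ k<δ δ+k<n = subst (_ <_) (cycleDistℕ-comm n (x + δ) x) (far-arc x δ k<δ δ+k<n)

module _ {k a b : ℕ} where
  private
    q = 1 + 2 * k

    [k+1]+k<2q : suc k + k < q + q
    [k+1]+k<2q = <-witness (2 * k) (eq k)
      where eq : ∀ k → (suc k + k) + suc (2 * k) ≡ (1 + 2 * k) + (1 + 2 * k)
            eq = solve-∀

    k<k+1+α : ∀ α → k < suc k + α
    k<k+1+α α = ≤-trans (n<1+n k) (m≤m+n (suc k) α)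

    [k+1+α]+k<2q : ∀ {α} → α < q → (suc k + α) + k < q + q
    [k+1+α]+k<2q {α} α<q = subst (_< q + q) (sym (eq k α)) (+-monoˡ-< q α<q)
      where eq : ∀ k α → (suc k + α) + k ≡ α + (1 + 2 * k)
            eq = solve-∀

    wraps⇒k<a : ∀ {α} → α < q → q + q ≤ (a + α) + suc k → k < a
    wraps⇒k<a α<q 2q≤v = +-cancelˡ-< (suc k) k a (subst₂ _<_ (q≡[k+1]+k k) (+-comm a (suc k)) q<a+[k+1])
      where
        q≡[k+1]+k : ∀ k → 1 + 2 * k ≡ suc k + k
        q≡[k+1]+k = solve-∀
        rotate : ∀ a q k → (a + q) + suc k ≡ q + (a + suc k)
        rotate = solve-∀
        q<a+[k+1] : q < a + suc k
        q<a+[k+1] = +-cancelˡ-< q q (a + suc k)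
          (subst (q + q <_) (rotate a q k) (≤-<-trans 2q≤v (+-monoˡ-< (suc k) (+-monoʳ-< a α<q))))

  far-inside-gap : a + q < b → b < q + q →
                   ∃ λ v → v < q + q × k < cycleDistℕ (q + q) v a × k < cycleDistℕ (q + q) v b
  far-inside-gap a+q<b b<2q with m≤n⇒∃[o]m+o≡n a+q<b
  ... | β , refl =
    a + suc k , <-trans (<-witness (k + β) (v+[k+β+1]≡b k a β)) b<2q ,
    far-arc a (suc k) (n<1+n k) [k+1]+k<2q ,
    subst (λ b → k < cycleDistℕ (q + q) (a + suc k) b) (sym (b≡v+[k+1+β] k a β))
      (far-arc′ (a + suc k) (suc k + β) (k<k+1+α β) (<-trans (<-witness a ([k+1+β]+k+[a+1]≡b k a β)) b<2q))
    where
      v+[k+β+1]≡b : ∀ k a β → (a + suc k) + suc (k + β) ≡ suc (a + (1 + 2 * k)) + β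
      v+[k+β+1]≡b = solve-∀
      b≡v+[k+1+β] : ∀ k a β → suc (a + (1 + 2 * k)) + β ≡ (a + suc k) + (suc k + β)
      b≡v+[k+1+β] = solve-∀
      [k+1+β]+k+[a+1]≡b : ∀ k a β → ((suc k + β) + k) + suc a ≡ suc (a + (1 + 2 * k)) + β
      [k+1+β]+k+[a+1]≡b = solve-∀

  far-outside-gap : b < a + q → a ≤ b → b < q + q →
                    ∃ λ v → v < q + q × k < cycleDistℕ (q + q) v a × k < cycleDistℕ (q + q) v b
  far-outside-gap b<a+q a≤b b<2q with m≤n⇒∃[o]m+o≡n a≤b
  ... | α , refl with (a + α) + suc k <? q + q
  ...   | yes v<2q =
    (a + α) + suc k , v<2q ,
    subst (λ v → k < cycleDistℕ (q + q) v a) (reassoc k a α)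
      (far-arc a (suc k + α) (k<k+1+α α) ([k+1+α]+k<2q (+-cancelˡ-< a α q b<a+q))) ,
    far-arc (a + α) (suc k) (n<1+n k) [k+1]+k<2q
    where
      reassoc : ∀ k a α → a + (suc k + α) ≡ (a + α) + suc k
      reassoc = solve-∀
  ...   | no v≮2q with m≤n⇒∃[o]m+o≡n (wraps⇒k<a (+-cancelˡ-< a α q b<a+q) (≮⇒≥ v≮2q))
  ...     | a′ , refl =
    a′ , ≤-<-trans (m≤n+m a′ (suc k)) (≤-<-trans (m≤m+n _ α) b<2q) ,
    subst (λ a → k < cycleDistℕ (q + q) a′ a) (+-comm a′ (suc k)) (far-arc′ a′ (suc k) (n<1+n k) [k+1]+k<2q) ,
    subst (λ b → k < cycleDistℕ (q + q) a′ b) (reassoc k a′ α)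
      (far-arc′ a′ (suc k + α) (k<k+1+α α) ([k+1+α]+k<2q (+-cancelˡ-< (suc k + a′) α q b<a+q)))
    where
      reassoc : ∀ k a′ α → a′ + (suc k + α) ≡ (suc k + a′) + α
      reassoc = solve-∀

-- The far vertex is a + k + 1 if the gap from a to b exceeds q, and otherwise b + k + 1 or a − k − 1,
-- one of which does not wrap round the cycle.
far-from-non-antipodal-pair : ∀ {k a b} → let q = 1 + 2 * k in a ≤ b → b < q + q → a + q ≢ b →
                              ∃ λ v → v < q + q × k < cycleDistℕ (q + q) v a × k < cycleDistℕ (q + q) v b
far-from-non-antipodal-pair {k} {a} {b} a≤b b<n a+q≢b with <-cmp (a + (1 + 2 * k)) b
... | tri≈ _ a+q≡b _ = contradiction a+q≡b a+q≢b
... | tri< a+q<b _ _ = far-inside-gap a+q<b b<n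
... | tri> _ _ b<a+q = far-outside-gap b<a+q a≤b b<n

¬dominating-if-far : (v : Fin n) → (∀ {w} → w ∈ S → k < cycleDist n v w) → ¬ IsDistKDominating n k S
¬dominating-if-far {n} {S} v far dominating with v ∈? S
... | yes v∈S = <⇒≱ (far v∈S) (≤-trans (≤-reflexive (cycleDistℕ-self n (toℕ v))) z≤n)
... | no v∉S  = let _ , w∈S , d≤k = dominating v v∉S in <⇒≱ (far w∈S) d≤k

dominating-pair⇒antipodal : let q = 1 + 2 * k in n ≡ q + q → (a b : Fin n) → toℕ a ≤ toℕ b →
                            S ⊆ ⁅ a ⁆ ∪ ⁅ b ⁆ → IsDistKDominating n k S → toℕ a + q ≡ toℕ b
dominating-pair⇒antipodal {k} {S = S} refl a b a≤b S⊆⁅a⁆∪⁅b⁆ dominating with toℕ a + (1 + 2 * k) ≟ toℕ b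
... | yes antipodal = antipodal
... | no ¬antipodal with far-from-non-antipodal-pair a≤b (toℕ<n b) ¬antipodal
...   | v , v<n , far-from-a , far-from-b = contradiction dominating (¬dominating-if-far (fromℕ< v<n) far)
  where
    far : ∀ {w} → w ∈ S → k < cycleDist _ (fromℕ< v<n) w
    far w∈S rewrite toℕ-fromℕ< v<n with x∈p∪q⁻ ⁅ a ⁆ ⁅ b ⁆ (S⊆⁅a⁆∪⁅b⁆ w∈S)
    ... | inj₁ w∈⁅a⁆ rewrite x∈⁅y⁆⇒x≡y a w∈⁅a⁆ = far-from-a
    ... | inj₂ w∈⁅b⁆ rewrite x∈⁅y⁆⇒x≡y b w∈⁅b⁆ = far-from-b

resolving⇒2≤∣S∣ : 3 ≤ n → IsResolving n S → 2 ≤ ∣ S ∣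
resolving⇒2≤∣S∣ {n} {S} 3≤n resolving with 2 ≤? ∣ S ∣
... | yes 2≤∣S∣ = 2≤∣S∣
... | no 2≰∣S∣ with ∣p∣≤1⇒⊆⁅i⁆ (fromℕ< (≤-trans (s≤s z≤n) 3≤n)) (s≤s⁻¹ (≰⇒> 2≰∣S∣))
...   | a , S⊆⁅a⁆ =
  contradiction resolving (¬resolving-⊆-axis 3≤n a (λ w∈S → inj₁ (cong toℕ (x∈⁅y⁆⇒x≡y a (S⊆⁅a⁆ w∈S)))))

¬resolving-dominating-⊆-pair : let q = 1 + 2 * k in 3 ≤ n → n ≡ q + q → (a b : Fin n) → toℕ a ≤ toℕ b →
                               S ⊆ ⁅ a ⁆ ∪ ⁅ b ⁆ → IsResolving n S → ¬ IsDistKDominating n k S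
¬resolving-dominating-⊆-pair {k} {n} {S} 3≤n n≡2q a b a≤b S⊆⁅a⁆∪⁅b⁆ resolving dominating =
  ¬resolving-⊆-axis 3≤n a on-axis resolving
  where
    a+q≡b = dominating-pair⇒antipodal n≡2q a b a≤b S⊆⁅a⁆∪⁅b⁆ dominating
    on-axis : ∀ {w} → w ∈ S → OnAxisThrough n (toℕ a) (toℕ w)
    on-axis w∈S with x∈p∪q⁻ ⁅ a ⁆ ⁅ b ⁆ (S⊆⁅a⁆∪⁅b⁆ w∈S)
    ... | inj₁ w∈⁅a⁆ = inj₁ (cong toℕ (x∈⁅y⁆⇒x≡y a w∈⁅a⁆))
    ... | inj₂ w∈⁅b⁆ = inj₂ (1 + 2 * k , n≡2q , trans a+q≡b (cong toℕ (sym (x∈⁅y⁆⇒x≡y b w∈⁅b⁆))))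

resolving-dominating⇒3≤∣S∣ : let q = 1 + 2 * k in 3 ≤ n → n ≡ q + q →
                             IsResolving n S → IsDistKDominating n k S → 3 ≤ ∣ S ∣
resolving-dominating⇒3≤∣S∣ {k} {n} {S} 3≤n n≡2q resolving dominating with 3 ≤? ∣ S ∣
... | yes 3≤∣S∣ = 3≤∣S∣
... | no 3≰∣S∣ with ∣p∣≤2⇒⊆⁅i⁆∪⁅j⁆ (fromℕ< (≤-trans (s≤s z≤n) 3≤n)) (s≤s⁻¹ (≰⇒> 3≰∣S∣))
...   | a , b , S⊆⁅a⁆∪⁅b⁆ with ≤-total (toℕ a) (toℕ b)
...     | inj₁ a≤b = contradiction dominating (¬resolving-dominating-⊆-pair 3≤n n≡2q a b a≤b S⊆⁅a⁆∪⁅b⁆ resolving)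
...     | inj₂ b≤a = contradiction dominating
          (¬resolving-dominating-⊆-pair 3≤n n≡2q b a b≤a (subst (S ⊆_) (∪-comm ⁅ a ⁆ ⁅ b ⁆) S⊆⁅a⁆∪⁅b⁆) resolving)

⌈n/[1+2k]⌉≤m : ∀ m → n ≤ m * (1 + 2 * k) → ceilDiv2k+1 n k ≤ m
⌈n/[1+2k]⌉≤m {n} {k} m n≤mq = s≤s⁻¹ (m<n*o⇒m/o<n (begin-strict
  n + 2 * k             <⟨ +-monoʳ-< n (n<1+n (2 * k)) ⟩
  n + (1 + 2 * k)       ≤⟨ +-monoˡ-≤ (1 + 2 * k) n≤mq ⟩
  m * (1 + 2 * k) + (1 + 2 * k) ≡⟨ +-comm (m * (1 + 2 * k)) _ ⟩
  suc m * (1 + 2 * k)   ∎))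
  where open ≤-Reasoning

n≤⌈n/[1+2k]⌉*[1+2k] : ∀ n k → n ≤ ceilDiv2k+1 n k * (1 + 2 * k)
n≤⌈n/[1+2k]⌉*[1+2k] n k = +-cancelʳ-≤ (2 * k) n _ (begin
  n + 2 * k                   ≡⟨ m≡m%n+[m/n]*n (n + 2 * k) (1 + 2 * k) ⟩
  (n + 2 * k) % (1 + 2 * k) + m * (1 + 2 * k) ≤⟨ +-monoˡ-≤ _ (s≤s⁻¹ (m%n<n (n + 2 * k) (1 + 2 * k))) ⟩
  2 * k + m * (1 + 2 * k)     ≡⟨ +-comm (2 * k) _ ⟩
  m * (1 + 2 * k) + 2 * k     ∎)
  where
    m = ceilDiv2k+1 n k
    open ≤-Reasoning

gammaRK≡-from-bounds : ∀ {n k m} → (∃ λ S → IsResolvingDistKDominating n k S × ∣ S ∣ ≤ m) →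
           (∀ S → IsResolvingDistKDominating n k S → m ≤ ∣ S ∣) → GammaRK≡ n k m
gammaRK≡-from-bounds (S , rd , ∣S∣≤m) lower = (S , rd , ≤-antisym ∣S∣≤m (lower S rd)) , lower

progression-resolving-dominating : ∀ {m} → 0 < m → n ≤ m * (1 + 2 * k) → progression (1 + 2 * k) m ⊆ S →
  (c : Fin n) → c ∈ S → 0 < toℕ c → toℕ c + toℕ c ≢ n → IsResolvingDistKDominating n k S
progression-resolving-dominating {n} {k} {m = m} 0<m n≤mq prog⊆S c c∈S 0<c c+c≢n =
  resolving-if-0-and-c z c z≡0 (prog⊆S (∈progression 0<m z≡0)) c∈S 0<c c+c≢n ,
  progression-dominating m n≤mq prog⊆S
  where
    z = fromℕ< (m<n⇒0<n (toℕ<n c))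
    z≡0 = toℕ-fromℕ< (m<n⇒0<n (toℕ<n c))

progression-upper-bound : ∀ {n k m} → let q = 1 + 2 * k in q < n → q + q ≢ n → 1 < m → n ≤ m * q →
                          ∃ λ S → IsResolvingDistKDominating n k S × ∣ S ∣ ≤ m
progression-upper-bound {n} {k} {m} q<n 2q≢n 1<m n≤mq =
  progression (1 + 2 * k) m ,
  progression-resolving-dominating (<-trans (s≤s z≤n) 1<m) n≤mq (λ i∈S → i∈S) vq
    (∈progression 1<m (trans vq≡q (sym (*-identityˡ _)))) (subst (0 <_) (sym vq≡q) (s≤s z≤n))
    (subst (λ x → x + x ≢ n) (sym vq≡q) 2q≢n) ,
  ∣progression∣≤m (1 + 2 * k) m
  where
    vq = fromℕ< q<n
    vq≡q = toℕ-fromℕ< q<n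

progression∪⁅1⁆-upper-bound : ∀ {n k m} → 3 ≤ n → 0 < m → n ≤ m * (1 + 2 * k) →
                              ∃ λ S → IsResolvingDistKDominating n k S × ∣ S ∣ ≤ suc m
progression∪⁅1⁆-upper-bound {n} {k} {m} 3≤n 0<m n≤mq =
  P ,
  progression-resolving-dominating 0<m n≤mq (q⊆p∪q (pointSet 1) _) v1 (x∈p∪q⁺ (inj₁ (∈pointSet v1≡1)))
    (subst (0 <_) (sym v1≡1) (s≤s z≤n)) (subst (λ x → x + x ≢ n) (sym v1≡1) (>⇒≢ 3≤n ∘ sym)) ,
  ≤-trans (∣p∪q∣≤∣p∣+∣q∣ {n} (pointSet 1) (progression (1 + 2 * k) m))
    (+-mono-≤ (∣pointSet∣≤1 {n} 1) (∣progression∣≤m (1 + 2 * k) m))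
  where
    P = pointSet 1 ∪ progression (1 + 2 * k) m
    v1 = fromℕ< (≤-trans (s≤s (s≤s z≤n)) 3≤n)
    v1≡1 = toℕ-fromℕ< (≤-trans (s≤s (s≤s z≤n)) 3≤n)

private
  4k+2≡2q : ∀ k → 4 * k + 2 ≡ (1 + 2 * k) + (1 + 2 * k)
  4k+2≡2q = solve-∀
  2q≡2*q : ∀ k → (1 + 2 * k) + (1 + 2 * k) ≡ 2 * (1 + 2 * k)
  2q≡2*q = solve-∀
  4k+1+1≡2q : ∀ k → suc (4 * k + 1) ≡ (1 + 2 * k) + (1 + 2 * k)
  4k+1+1≡2q = solve-∀
  4k+3≡2q+1 : ∀ k → 4 * k + 3 ≡ suc ((1 + 2 * k) + (1 + 2 * k))
  4k+3≡2q+1 = solve-∀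

γ-below-4k+2 : 3 ≤ n → n ≤ 4 * k + 1 → GammaRK≡ n k 2
γ-below-4k+2 {n} {k} 3≤n n≤4k+1 = gammaRK≡-from-bounds upper (λ S (resolving , _) → resolving⇒2≤∣S∣ 3≤n resolving)
  where
    n<2q : n < (1 + 2 * k) + (1 + 2 * k)
    n<2q = subst (n <_) (4k+1+1≡2q k) (s≤s n≤4k+1)
    upper : ∃ λ S → IsResolvingDistKDominating n k S × ∣ S ∣ ≤ 2
    upper with n ≤? 1 + 2 * k
    ... | yes n≤q = progression∪⁅1⁆-upper-bound 3≤n (s≤s z≤n) (subst (n ≤_) (sym (*-identityˡ _)) n≤q)
    ... | no n≰q  =
      progression-upper-bound (≰⇒> n≰q) (>⇒≢ n<2q) (s≤s (s≤s z≤n)) (≤-trans (<⇒≤ n<2q) (≤-reflexive (2q≡2*q k)))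

γ-at-4k+2 : 3 ≤ n → n ≡ 4 * k + 2 → GammaRK≡ n k 3
γ-at-4k+2 {n} {k} 3≤n n≡4k+2 =
  gammaRK≡-from-bounds (progression∪⁅1⁆-upper-bound 3≤n (s≤s z≤n) (≤-reflexive (trans n≡2q (2q≡2*q k))))
    (λ S (resolving , dominating) → resolving-dominating⇒3≤∣S∣ 3≤n n≡2q resolving dominating)
  where
    n≡2q = trans n≡4k+2 (4k+2≡2q k)

γ-above-4k+2 : n ≥ 4 * k + 3 → GammaRK≡ n k (ceilDiv2k+1 n k)
γ-above-4k+2 {n} {k} n≥4k+3 =
  gammaRK≡-from-bounds (progression-upper-bound q<n (<⇒≢ 2q<n) 1<m n≤mq)
    (λ S (_ , dominating) → ⌈n/[1+2k]⌉≤m {k = k} ∣ S ∣ (dominating⇒n≤∣S∣*[1+2k] dominating))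
  where
    q = 1 + 2 * k
    2q<n : q + q < n
    2q<n = subst (_≤ n) (4k+3≡2q+1 k) n≥4k+3
    q<n : q < n
    q<n = <-trans (m<m+n q (s≤s z≤n)) 2q<n
    n≤mq = n≤⌈n/[1+2k]⌉*[1+2k] n k
    1<m : 1 < ceilDiv2k+1 n k
    1<m = *-cancelʳ-< q 1 (ceilDiv2k+1 n k)
            (subst (_< ceilDiv2k+1 n k * q) (sym (*-identityˡ q)) (<-≤-trans q<n n≤mq))

proposition2p3 : (n k : ℕ) → 3 ≤ n → 1 ≤ k →
    ((n ≤ 4 * k + 1 → GammaRK≡ n k 2)
    × (n ≡ 4 * k + 2 → GammaRK≡ n k 3)
    × (n ≥ 4 * k + 3 → GammaRK≡ n k (ceilDiv2k+1 n k)))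
proposition2p3 n k 3≤n _ = γ-below-4k+2 3≤n , γ-at-4k+2 3≤n , γ-above-4k+2
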